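{- Let $M$ be a matroid with at least four elements and let $G$ be a connected weak framework for $M$. If $C$ is a circuit of $M$, then $G[C]$ has at most two components.
   Context: For a graph $G$ and a vertex $v$, $\mathrm{loops}_G(v)$ denotes the set of loop-edges of $G$ at $v$. Graphs are finite and may have loops and parallel edges. For a set $X$ of edges, $G[X]$ is the subgraph of $G$ with edge-set $X$ and no isolated vertices. A graph $G$ is a weak framework for a matroid $M$ if (1) $E(G)=E(M)$; (2) $r_M(E(H))\le |V(H)|$ for each component $H$ of $G$; and (3) for each vertex $v$ of $G$, $\mathrm{cl}_M(E(G-v))\subseteq E(G-v)\cup \mathrm{loops}_G(v)$. -}

module Defs where

open import Data.Nat using (ℕ; _≤_; _<_; _+_)
open import Data.Fin using (Fin; _≟_)
open import Data.Fin.Subset using (Subset; _∈_; _⊆_; _⊂_; _∪_; _∩_; ⁅_⁆; ∣_∣; ⊤; inside; outside)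
open import Data.Vec using (tabulate)
open import Data.Product using (_×_; _,_; proj₁; proj₂)
open import Data.Sum using (_⊎_)
open import Data.Bool using (Bool; true; false; if_then_else_; _∨_)
open import Relation.Nullary.Decidable using (⌊_⌋)
open import Relation.Binary.PropositionalEquality using (_≡_)
open import Function.Bundles using (_⇔_)

record Matroid (n : ℕ) : Set where
  field
    rank     : Subset n → ℕ
    rank-≤   : ∀ X → rank X ≤ ∣ X ∣
    rank-mono : ∀ {X Y} → X ⊆ Y → rank X ≤ rank Y
    rank-sub : ∀ X Y → rank (X ∪ Y) + rank (X ∩ Y)
                       ≤ rank X + rank Y
open Matroid public

_∈cl[_]_ : ∀ {n} → Fin n → Matroid n → Subset n → Set
e ∈cl[ M ] X = rank M (X ∪ ⁅ e ⁆) ≡ rank M X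

Independent : ∀ {n} → Matroid n → Subset n → Set
Independent M X = rank M X ≡ ∣ X ∣

Dependent : ∀ {n} → Matroid n → Subset n → Set
Dependent M X = rank M X < ∣ X ∣

IsCircuit : ∀ {n} → Matroid n → Subset n → Set
IsCircuit M C = Dependent M C × (∀ X → X ⊂ C → Independent M X)

-- Graphs with edge set Fin n (loops and parallel edges allowed) and
-- vertex set Fin m.  Each edge has two (unordered) ends.

record Graph (n : ℕ) : Set where
  field
    nV   : ℕ
    ends : Fin n → Fin nV × Fin nV
open Graph public

Vtx : ∀ {n} → Graph n → Set
Vtx G = Fin (nV G)

end₁ end₂ : ∀ {n} (G : Graph n) → Fin n → Vtx G
end₁ G e = proj₁ (ends G e)
end₂ G e = proj₂ (ends G e)

IsLoopAt : ∀ {n} (G : Graph n) → Vtx G → Fin n → Set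
IsLoopAt G v e = (end₁ G e ≡ v) × (end₂ G e ≡ v)

data Reach {n} (G : Graph n) (X : Subset n) : Vtx G → Vtx G → Set where
  here  : ∀ {u} → Reach G X u u
  fwd   : ∀ {u} e → e ∈ X → Reach G X u (end₁ G e) → Reach G X u (end₂ G e)
  bwd   : ∀ {u} e → e ∈ X → Reach G X u (end₂ G e) → Reach G X u (end₁ G e)

Connected : ∀ {n} → Graph n → Set
Connected {n} G = ∀ (u w : Vtx G) → Reach G ⊤ u w

EdgesAvoiding : ∀ {n} (G : Graph n) → Vtx G → Subset n
EdgesAvoiding G v =
  tabulate (λ e → if ⌊ v ≟ end₁ G e ⌋ ∨ ⌊ v ≟ end₂ G e ⌋ then outside else inside)

-- Weak framework.  Condition (2) is stated for the component containing
-- an arbitrary vertex u: X is its edge set and W its vertex set.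
IsWeakFramework : ∀ {n} → Matroid n → Graph n → Set
IsWeakFramework {n} M G =
    (∀ (u : Vtx G) (X : Subset n) (W : Subset (nV G))
       → (∀ e → (e ∈ X) ⇔ Reach G ⊤ u (end₁ G e))
       → (∀ w → (w ∈ W) ⇔ Reach G ⊤ u w)
       → rank M X ≤ ∣ W ∣)
  × (∀ (v : Vtx G) (e : Fin n)
       → e ∈cl[ M ] EdgesAvoiding G v
       → (e ∈ EdgesAvoiding G v) ⊎ IsLoopAt G v e)

SameComp : ∀ {n} (G : Graph n) → Subset n → Fin n → Fin n → Set
SameComp G X e f = Reach G X (end₁ G e) (end₁ G f)

-- G[X] has at most two components: G[X] has no isolated vertices, so every
-- component contains an edge of X; hence among any three edges of X two
-- lie in the same component.
AtMostTwoComponents : ∀ {n} (G : Graph n) → Subset n → Set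
AtMostTwoComponents {n} G X =
  ∀ (e f g : Fin n) → e ∈ X → f ∈ X → g ∈ X →
    SameComp G X e f ⊎ SameComp G X e g ⊎ SameComp G X f g

-- Suppose edges e, f, g of the circuit C lie in three different components of G[C];
-- let V₁ (with edge set A₁) be the component of e. Grow from e the connected vertex
-- set T whose vertices meeting C all lie in V₁, and leave it along an edge p on a walk
-- towards f. The new end y of p meets C outside V₁; let V_y (edges A_y) be its
-- component and B the rest of C, which contains f or g. In a weak framework an edge
-- reaching a vertex untouched by X raises the rank of X, so a connected edge set
-- spanning k new vertices raises the rank by at least k, while r(X) ≤ |V(X)|.
-- Together with submodularity and the independence of the proper subsets of C this
-- yields eight linear inequalities between the ranks of C, A_y ∪ E(T), B ∪ E(T),
-- C ∪ E(T), A_y ∪ E(T) + p, C ∪ E(T) + p and the sizes of A₁, A_y, B, V₁, V_y, T;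
-- a weighted sum of them reads 1 ≤ 0.

module Submission where

open import Defs
open import Data.Nat using (ℕ; zero; suc; s≤s; _≤_; _<_; _+_; _*_; _<?_)
open import Data.Nat.Properties hiding (_≟_)
open import Data.Nat.Tactic.RingSolver using (solve-∀)
open import Data.Fin using (Fin; _≟_)
open import Data.Fin.Properties using (any?)
open import Data.Fin.Subset using (Subset; _∈_; _∉_; _⊆_; _∪_; _∩_; ⁅_⁆; ∣_∣; ⊤; inside; outside)
  renaming (⊥ to ∅)
open import Data.Fin.Subset.Properties
open import Data.Vec using (tabulate; _∷_; [])
open import Data.Vec.Properties using (lookup∘tabulate; []=⇒lookup; lookup⇒[]=)
open import Data.Product using (∃; ∃₂; _×_; _,_; proj₁; proj₂)
open import Data.Sum using (_⊎_; inj₁; inj₂; [_,_]′)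
open import Data.Bool using (if_then_else_; _∨_)
open import Data.Empty using (⊥; ⊥-elim)
open import Function using (_∘_)
open import Function.Bundles using (mk⇔)
open import Relation.Nullary using (¬_; Dec; yes; no; does; ¬?)
open import Relation.Nullary.Decidable using (⌊_⌋; _×-dec_; _⊎-dec_)
open import Relation.Binary.PropositionalEquality

-- Finite subsets

select : ∀ {m} {P : Fin m → Set} → (∀ i → Dec (P i)) → Subset m
select d = tabulate (λ i → if does (d i) then inside else outside)

module _ {m} {P : Fin m → Set} (d : ∀ i → Dec (P i)) where

  ∈-select⁺ : ∀ {i} → P i → i ∈ select d
  ∈-select⁺ {i} p = lookup⇒[]= i _ (trans (lookup∘tabulate _ i) (chosen (d i) p))
    where
    chosen : ∀ {Q : Set} (q : Dec Q) → Q → (if does q then inside else outside) ≡ inside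
    chosen (yes _) _ = refl
    chosen (no ¬q) q = ⊥-elim (¬q q)

  ∈-select⁻ : ∀ {i} → i ∈ select d → P i
  ∈-select⁻ {i} i∈ = chosen (d i) (trans (sym (lookup∘tabulate _ i)) ([]=⇒lookup i∈))
    where
    chosen : ∀ {Q : Set} (q : Dec Q) → (if does q then inside else outside) ≡ inside → Q
    chosen (yes q) _ = q
    chosen (no _) ()

Disjoint : ∀ {m} → Subset m → Subset m → Set
Disjoint p q = ∀ {x} → x ∈ p → x ∉ q

⊆∪ˡ : ∀ {m} {p q : Subset m} → p ⊆ p ∪ q
⊆∪ˡ {q = q} = p⊆p∪q q

⊆∪ʳ : ∀ {m} {p q : Subset m} → q ⊆ p ∪ q
⊆∪ʳ {p = p} {q} = q⊆p∪q p q

∪-least : ∀ {m} {p q r : Subset m} → p ⊆ r → q ⊆ r → p ∪ q ⊆ r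
∪-least {p = p} {q} p⊆r q⊆r x∈ = [ p⊆r , q⊆r ]′ (x∈p∪q⁻ p q x∈)

∉∪ : ∀ {m} {p q : Subset m} {x} → x ∉ p → x ∉ q → x ∉ p ∪ q
∉∪ {p = p} {q} x∉p x∉q x∈ = [ x∉p , x∉q ]′ (x∈p∪q⁻ p q x∈)

∣p∪q∣+∣p∩q∣≡∣p∣+∣q∣ : ∀ {m} (p q : Subset m) → ∣ p ∪ q ∣ + ∣ p ∩ q ∣ ≡ ∣ p ∣ + ∣ q ∣
∣p∪q∣+∣p∩q∣≡∣p∣+∣q∣ [] [] = refl
∣p∪q∣+∣p∩q∣≡∣p∣+∣q∣ (inside ∷ p) (inside ∷ q) = cong suc (begin
  ∣ p ∪ q ∣ + suc ∣ p ∩ q ∣  ≡⟨ +-suc ∣ p ∪ q ∣ ∣ p ∩ q ∣ ⟩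
  suc (∣ p ∪ q ∣ + ∣ p ∩ q ∣) ≡⟨ cong suc (∣p∪q∣+∣p∩q∣≡∣p∣+∣q∣ p q) ⟩
  suc (∣ p ∣ + ∣ q ∣)         ≡⟨ +-suc ∣ p ∣ ∣ q ∣ ⟨
  ∣ p ∣ + suc ∣ q ∣           ∎)
  where open ≡-Reasoning
∣p∪q∣+∣p∩q∣≡∣p∣+∣q∣ (inside ∷ p) (outside ∷ q) = cong suc (∣p∪q∣+∣p∩q∣≡∣p∣+∣q∣ p q)
∣p∪q∣+∣p∩q∣≡∣p∣+∣q∣ (outside ∷ p) (inside ∷ q) =
  trans (cong suc (∣p∪q∣+∣p∩q∣≡∣p∣+∣q∣ p q)) (sym (+-suc ∣ p ∣ ∣ q ∣))
∣p∪q∣+∣p∩q∣≡∣p∣+∣q∣ (outside ∷ p) (outside ∷ q) = ∣p∪q∣+∣p∩q∣≡∣p∣+∣q∣ p q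

∣p∪q∣≤∣p∣+∣q∣ : ∀ {m} (p q : Subset m) → ∣ p ∪ q ∣ ≤ ∣ p ∣ + ∣ q ∣
∣p∪q∣≤∣p∣+∣q∣ p q = subst (∣ p ∪ q ∣ ≤_) (∣p∪q∣+∣p∩q∣≡∣p∣+∣q∣ p q) (m≤m+n _ _)

disjoint⇒∣p∪q∣≡∣p∣+∣q∣ : ∀ {m} {p q : Subset m} → Disjoint p q → ∣ p ∪ q ∣ ≡ ∣ p ∣ + ∣ q ∣
disjoint⇒∣p∪q∣≡∣p∣+∣q∣ {m} {p} {q} p∩q=∅ = begin
  ∣ p ∪ q ∣                  ≡⟨ +-identityʳ _ ⟨
  ∣ p ∪ q ∣ + 0              ≡⟨ cong (∣ p ∪ q ∣ +_) ∣p∩q∣≡0 ⟨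
  ∣ p ∪ q ∣ + ∣ p ∩ q ∣      ≡⟨ ∣p∪q∣+∣p∩q∣≡∣p∣+∣q∣ p q ⟩
  ∣ p ∣ + ∣ q ∣              ∎
  where
  open ≡-Reasoning
  ∣p∩q∣≡0 : ∣ p ∩ q ∣ ≡ 0
  ∣p∩q∣≡0 = trans (cong ∣_∣ (Empty-unique (λ (x , x∈) → let (x∈p , x∈q) = x∈p∩q⁻ p q x∈ in p∩q=∅ x∈p x∈q)))
                  (∣⊥∣≡0 m)

x∉p⇒∣p∪⁅x⁆∣≡1+∣p∣ : ∀ {m} {p : Subset m} {x} → x ∉ p → ∣ p ∪ ⁅ x ⁆ ∣ ≡ suc ∣ p ∣
x∉p⇒∣p∪⁅x⁆∣≡1+∣p∣ {p = p} {x} x∉p = begin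
  ∣ p ∪ ⁅ x ⁆ ∣     ≡⟨ disjoint⇒∣p∪q∣≡∣p∣+∣q∣ (λ y∈p y∈⁅x⁆ → x∉p (subst (_∈ p) (x∈⁅y⁆⇒x≡y x y∈⁅x⁆) y∈p)) ⟩
  ∣ p ∣ + ∣ ⁅ x ⁆ ∣ ≡⟨ cong (∣ p ∣ +_) (∣⁅x⁆∣≡1 x) ⟩
  ∣ p ∣ + 1         ≡⟨ +-comm ∣ p ∣ 1 ⟩
  suc ∣ p ∣         ∎
  where open ≡-Reasoning

⁅x⁆⊆p : ∀ {m} {p : Subset m} {x} → x ∈ p → ⁅ x ⁆ ⊆ p
⁅x⁆⊆p {p = p} {x} x∈p y∈⁅x⁆ = subst (_∈ p) (sym (x∈⁅y⁆⇒x≡y x y∈⁅x⁆)) x∈p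

∣p∣<∣q∣⇒∃x∈q∖p : ∀ {m} {p q : Subset m} → ∣ p ∣ < ∣ q ∣ → ∃ λ x → x ∈ q × x ∉ p
∣p∣<∣q∣⇒∃x∈q∖p {p = p} {q} ∣p∣<∣q∣ with any? (λ x → (x ∈? q) ×-dec ¬? (x ∈? p))
... | yes x∈q∖p = x∈q∖p
... | no q∖p=∅ = ⊥-elim (<⇒≱ ∣p∣<∣q∣ (p⊆q⇒∣p∣≤∣q∣ q⊆p))
  where
  q⊆p : q ⊆ p
  q⊆p {x} x∈q with x ∈? p
  ... | yes x∈p = x∈p
  ... | no x∉p = ⊥-elim (q∖p=∅ (x , x∈q , x∉p))

-- Walks in a graph

module _ {n} (G : Graph n) where

  Incident : Fin n → Vtx G → Set
  Incident e v = end₁ G e ≡ v ⊎ end₂ G e ≡ v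

  Avoids : Subset n → Vtx G → Set
  Avoids X v = ∀ {e} → e ∈ X → ¬ Incident e v

  Inside : Subset (nV G) → Fin n → Set
  Inside S e = end₁ G e ∈ S × end₂ G e ∈ S

  Joins : Subset (nV G) → Fin n → Vtx G → Set
  Joins S e v = (end₁ G e ∈ S × end₂ G e ≡ v) ⊎ (end₂ G e ∈ S × end₁ G e ≡ v)

  inside-incident : ∀ {S e w} → Inside S e → Incident e w → w ∈ S
  inside-incident (e₁∈S , _) (inj₁ refl) = e₁∈S
  inside-incident (_ , e₂∈S) (inj₂ refl) = e₂∈S

  inside-mono : ∀ {S S' e} → S ⊆ S' → Inside S e → Inside S' e
  inside-mono S⊆S' (e₁∈S , e₂∈S) = S⊆S' e₁∈S , S⊆S' e₂∈S

  joins-incident : ∀ {S e v} → Joins S e v → Incident e v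
  joins-incident (inj₁ (_ , e₂≡v)) = inj₂ e₂≡v
  joins-incident (inj₂ (_ , e₁≡v)) = inj₁ e₁≡v

  joins-inside : ∀ {S e v} → Joins S e v → Inside (S ∪ ⁅ v ⁆) e
  joins-inside (inj₁ (e₁∈S , refl)) = ⊆∪ˡ e₁∈S , ⊆∪ʳ (x∈⁅x⁆ _)
  joins-inside (inj₂ (e₂∈S , refl)) = ⊆∪ʳ (x∈⁅x⁆ _) , ⊆∪ˡ e₂∈S

  joins-nonloop : ∀ {S e v} → v ∉ S → Joins S e v → end₁ G e ≢ end₂ G e
  joins-nonloop {S} v∉S (inj₁ (e₁∈S , refl)) e₁≡e₂ = v∉S (subst (_∈ S) e₁≡e₂ e₁∈S)
  joins-nonloop {S} v∉S (inj₂ (e₂∈S , refl)) e₁≡e₂ = v∉S (subst (_∈ S) (sym e₁≡e₂) e₂∈S)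

  Reach-trans : ∀ {Y u v w} → Reach G Y u v → Reach G Y v w → Reach G Y u w
  Reach-trans p here = p
  Reach-trans p (fwd e e∈Y q) = fwd e e∈Y (Reach-trans p q)
  Reach-trans p (bwd e e∈Y q) = bwd e e∈Y (Reach-trans p q)

  Reach-sym : ∀ {Y u v} → Reach G Y u v → Reach G Y v u
  Reach-sym here = here
  Reach-sym (fwd e e∈Y q) = Reach-trans (bwd e e∈Y here) (Reach-sym q)
  Reach-sym (bwd e e∈Y q) = Reach-trans (fwd e e∈Y here) (Reach-sym q)

  exit : ∀ {Y S u w} → Reach G Y u w → u ∈ S → w ∉ S → ∃₂ λ e v → e ∈ Y × v ∉ S × Joins S e v
  exit here u∈S u∉S = ⊥-elim (u∉S u∈S)
  exit {S = S} (fwd e e∈Y q) u∈S w∉S with end₁ G e ∈? S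
  ... | yes e₁∈S = e , end₂ G e , e∈Y , w∉S , inj₁ (e₁∈S , refl)
  ... | no e₁∉S = exit q u∈S e₁∉S
  exit {S = S} (bwd e e∈Y q) u∈S w∉S with end₂ G e ∈? S
  ... | yes e₂∈S = e , end₁ G e , e∈Y , w∉S , inj₂ (e₂∈S , refl)
  ... | no e₂∉S = exit q u∈S e₂∉S

  -- The set of vertices reachable from u is computed as the closure of ⁅ u ⁆ under
  -- adding the far ends of edges of Y; it stabilises after nV G steps.
  module Closure (Y : Subset n) (u : Vtx G) where

    Adjacent? : ∀ S w → Dec (w ∈ S ⊎ ∃ λ e → e ∈ Y × Joins S e w)
    Adjacent? S w = (w ∈? S) ⊎-dec any? (λ e → (e ∈? Y) ×-dec
      (((end₁ G e ∈? S) ×-dec (end₂ G e ≟ w)) ⊎-dec ((end₂ G e ∈? S) ×-dec (end₁ G e ≟ w))))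

    expand : Subset (nV G) → Subset (nV G)
    expand S = select (Adjacent? S)

    ⊆-expand : ∀ {S} → S ⊆ expand S
    ⊆-expand w∈S = ∈-select⁺ (Adjacent? _) (inj₁ w∈S)

    expand-mono : ∀ {S S'} → S ⊆ S' → expand S ⊆ expand S'
    expand-mono {S} {S'} S⊆S' w∈ with ∈-select⁻ (Adjacent? S) w∈
    ... | inj₁ w∈S = ⊆-expand (S⊆S' w∈S)
    ... | inj₂ (e , e∈Y , inj₁ (e₁∈S , e₂≡w)) = ∈-select⁺ (Adjacent? S') (inj₂ (e , e∈Y , inj₁ (S⊆S' e₁∈S , e₂≡w)))
    ... | inj₂ (e , e∈Y , inj₂ (e₂∈S , e₁≡w)) = ∈-select⁺ (Adjacent? S') (inj₂ (e , e∈Y , inj₂ (S⊆S' e₂∈S , e₁≡w)))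

    iterate : ℕ → Subset (nV G)
    iterate zero = ⁅ u ⁆
    iterate (suc k) = expand (iterate k)

    iterate-sound : ∀ k {w} → w ∈ iterate k → Reach G Y u w
    iterate-sound zero w∈ = subst (Reach G Y u) (sym (x∈⁅y⁆⇒x≡y u w∈)) here
    iterate-sound (suc k) w∈ with ∈-select⁻ (Adjacent? (iterate k)) w∈
    ... | inj₁ w∈S = iterate-sound k w∈S
    ... | inj₂ (e , e∈Y , inj₁ (e₁∈S , refl)) = fwd e e∈Y (iterate-sound k e₁∈S)
    ... | inj₂ (e , e∈Y , inj₂ (e₂∈S , refl)) = bwd e e∈Y (iterate-sound k e₂∈S)

    u∈iterate : ∀ k → u ∈ iterate k
    u∈iterate zero = x∈⁅x⁆ u
    u∈iterate (suc k) = ⊆-expand (u∈iterate k)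

    closed-or-grows : ∀ k → expand (iterate k) ⊆ iterate k ⊎ k < ∣ iterate k ∣
    closed-or-grows zero = inj₂ (≤-reflexive (sym (∣⁅x⁆∣≡1 u)))
    closed-or-grows (suc k) with any? (λ w → (w ∈? expand (iterate k)) ×-dec ¬? (w ∈? iterate k))
    ... | no nothing-new = inj₁ (expand-mono closed)
      where
      closed : expand (iterate k) ⊆ iterate k
      closed {w} w∈ with w ∈? iterate k
      ... | yes w∈S = w∈S
      ... | no w∉S = ⊥-elim (nothing-new (w , w∈ , w∉S))
    ... | yes (w , w∈ , w∉S) with closed-or-grows k
    ...   | inj₁ closed = ⊥-elim (w∉S (closed w∈))
    ...   | inj₂ k<∣S∣ = inj₂ (<-≤-trans (s≤s k<∣S∣) (p⊂q⇒∣p∣<∣q∣ (⊆-expand , w , w∈ , w∉S)))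

    reachable : Subset (nV G)
    reachable = iterate (nV G)

    reachable-closed : expand reachable ⊆ reachable
    reachable-closed with closed-or-grows (nV G)
    ... | inj₁ closed = closed
    ... | inj₂ nV<∣S∣ = ⊥-elim (<⇒≱ nV<∣S∣ (∣p∣≤n reachable))

    reachable⁺ : ∀ {w} → Reach G Y u w → w ∈ reachable
    reachable⁺ here = u∈iterate (nV G)
    reachable⁺ (fwd e e∈Y q) =
      reachable-closed (∈-select⁺ (Adjacent? _) (inj₂ (e , e∈Y , inj₁ (reachable⁺ q , refl))))
    reachable⁺ (bwd e e∈Y q) =
      reachable-closed (∈-select⁺ (Adjacent? _) (inj₂ (e , e∈Y , inj₂ (reachable⁺ q , refl))))

    reachable⁻ : ∀ {w} → w ∈ reachable → Reach G Y u w
    reachable⁻ = iterate-sound (nV G)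

  open Closure public using (reachable; reachable⁺; reachable⁻)

  Reach? : ∀ Y u w → Dec (Reach G Y u w)
  Reach? Y u w with w ∈? reachable Y u
  ... | yes w∈ = yes (reachable⁻ Y u w∈)
  ... | no w∉ = no (w∉ ∘ reachable⁺ Y u)

  induced? : ∀ Y S e → Dec (e ∈ Y × Inside S e)
  induced? Y S e = (e ∈? Y) ×-dec ((end₁ G e ∈? S) ×-dec (end₂ G e ∈? S))

  induced : Subset n → Subset (nV G) → Subset n
  induced Y S = select (induced? Y S)

  ∈induced⁺ : ∀ {Y S e} → e ∈ Y → Inside S e → e ∈ induced Y S
  ∈induced⁺ {Y} {S} e∈Y e-inside = ∈-select⁺ (induced? Y S) (e∈Y , e-inside)

  ∈induced⁻ : ∀ {Y S e} → e ∈ induced Y S → e ∈ Y × Inside S e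
  ∈induced⁻ {Y} {S} = ∈-select⁻ (induced? Y S)

  induced⊆ : ∀ {Y S} → induced Y S ⊆ Y
  induced⊆ = proj₁ ∘ ∈induced⁻

  induced-mono : ∀ {Y S S'} → S ⊆ S' → induced Y S ⊆ induced Y S'
  induced-mono S⊆S' e∈ = let (e∈Y , e-inside) = ∈induced⁻ e∈ in ∈induced⁺ e∈Y (inside-mono S⊆S' e-inside)

  ∈EdgesAvoiding⁺ : ∀ {v e} → ¬ Incident e v → e ∈ EdgesAvoiding G v
  ∈EdgesAvoiding⁺ {v} {e} ¬inc = lookup⇒[]= e _ (trans (lookup∘tabulate _ e)
      (kept (v ≟ end₁ G e) (v ≟ end₂ G e) (¬inc ∘ inj₁ ∘ sym) (¬inc ∘ inj₂ ∘ sym)))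
    where
    kept : ∀ {A B : Set} (a : Dec A) (b : Dec B) → ¬ A → ¬ B → (if ⌊ a ⌋ ∨ ⌊ b ⌋ then outside else inside) ≡ inside
    kept (yes a) _ ¬a _ = ⊥-elim (¬a a)
    kept (no _) (yes b) _ ¬b = ⊥-elim (¬b b)
    kept (no _) (no _) _ _ = refl

  ∉EdgesAvoiding : ∀ {v e} → Incident e v → e ∉ EdgesAvoiding G v
  ∉EdgesAvoiding {v} {e} inc e∈ =
    let (¬a , ¬b) = kept (v ≟ end₁ G e) (v ≟ end₂ G e) (trans (sym (lookup∘tabulate _ e)) ([]=⇒lookup e∈))
    in [ ¬a ∘ sym , ¬b ∘ sym ]′ inc
    where
    kept : ∀ {A B : Set} (a : Dec A) (b : Dec B) → (if ⌊ a ⌋ ∨ ⌊ b ⌋ then outside else inside) ≡ inside → ¬ A × ¬ B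
    kept (yes _) _ ()
    kept (no _) (yes _) ()
    kept (no ¬a) (no ¬b) _ = ¬a , ¬b

module _ {n} (M : Matroid n) {C : Subset n} (circuit : IsCircuit M C) where

  rank-of-proper-part : ∀ {X c} → X ⊆ C → c ∈ C → c ∉ X → ∣ X ∣ ≤ rank M X
  rank-of-proper-part X⊆C c∈C c∉X = ≤-reflexive (sym (proj₂ circuit _ (X⊆C , _ , c∈C , c∉X)))

  rank-of-proper-disjoint-parts : ∀ {X Y c} → Disjoint X Y → X ∪ Y ⊆ C → c ∈ C → c ∉ X ∪ Y
    → ∣ X ∣ + ∣ Y ∣ ≤ rank M (X ∪ Y)
  rank-of-proper-disjoint-parts {X} {Y} X∩Y=∅ X∪Y⊆C c∈C c∉X∪Y =
    subst (_≤ rank M (X ∪ Y)) (disjoint⇒∣p∪q∣≡∣p∣+∣q∣ X∩Y=∅) (rank-of-proper-part X∪Y⊆C c∈C c∉X∪Y)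

-- Rank in a weak framework

module WeakFramework {n} (M : Matroid n) (G : Graph n) (wf : IsWeakFramework M G) where

  private
    r : Subset n → ℕ
    r = rank M

  -- By condition (3) at v, e ∉ cl(E(G − v)); submodularity passes this rank jump
  -- down to X ⊆ E(G − v).
  rank-suc-at-new-vertex : ∀ {X e v} → Avoids G X v → Incident G e v → end₁ G e ≢ end₂ G e
    → suc (r X) ≤ r (X ∪ ⁅ e ⁆)
  rank-suc-at-new-vertex {X} {e} {v} X-avoids-v e~v nonloop =
    +-cancelˡ-≤ (r Ev) _ _ (begin
      r Ev + suc (r X)                               ≡⟨ +-suc (r Ev) (r X) ⟩
      suc (r Ev) + r X                               ≤⟨ +-mono-≤ jump (rank-mono M X⊆Xe∩Ev) ⟩
      r (Ev ∪ ⁅ e ⁆) + r ((X ∪ ⁅ e ⁆) ∩ Ev)         ≤⟨ +-monoˡ-≤ _ (rank-mono M (∪-least ⊆∪ʳ (⊆∪ˡ ∘ ⊆∪ʳ))) ⟩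
      r ((X ∪ ⁅ e ⁆) ∪ Ev) + r ((X ∪ ⁅ e ⁆) ∩ Ev)   ≤⟨ rank-sub M (X ∪ ⁅ e ⁆) Ev ⟩
      r (X ∪ ⁅ e ⁆) + r Ev                           ≡⟨ +-comm _ (r Ev) ⟩
      r Ev + r (X ∪ ⁅ e ⁆)                           ∎)
    where
    open ≤-Reasoning
    Ev : Subset n
    Ev = EdgesAvoiding G v
    X⊆Xe∩Ev : X ⊆ (X ∪ ⁅ e ⁆) ∩ Ev
    X⊆Xe∩Ev f∈X = x∈p∩q⁺ (⊆∪ˡ f∈X , ∈EdgesAvoiding⁺ G (X-avoids-v f∈X))
    e∉cl : ¬ (e ∈cl[ M ] Ev)
    e∉cl e∈cl = [ ∉EdgesAvoiding G e~v , (λ (e₁≡v , e₂≡v) → nonloop (trans e₁≡v (sym e₂≡v))) ]′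
                  (proj₂ wf v e e∈cl)
    jump : suc (r Ev) ≤ r (Ev ∪ ⁅ e ⁆)
    jump = ≤∧≢⇒< (rank-mono M ⊆∪ˡ) (e∉cl ∘ sym)

  module Growth (X Y : Subset n) (T : Subset (nV G)) (u : Vtx G)
                (Y-inside : ∀ {e} → e ∈ Y → Inside G T e)
                (Y-spans : ∀ {w} → w ∈ T → Reach G Y u w) where

    AvoidsOutside : Subset (nV G) → Set
    AvoidsOutside S = ∀ {w} → w ∈ T → w ∉ S → Avoids G X w

    rank-extend : ∀ {S e v} → AvoidsOutside S → e ∈ Y → v ∉ S → Joins G S e v
      → suc (r (X ∪ induced G Y S)) ≤ r (X ∪ induced G Y (S ∪ ⁅ v ⁆))
    rank-extend {S} {e} {v} X-avoids e∈Y v∉S e-joins =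
      ≤-trans (rank-suc-at-new-vertex XY-avoids-v (joins-incident G e-joins) (joins-nonloop G v∉S e-joins))
              (rank-mono M (∪-least (∪-least ⊆∪ˡ (⊆∪ʳ ∘ induced-mono G ⊆∪ˡ)) e∈new))
      where
      XY-avoids-v : Avoids G (X ∪ induced G Y S) v
      XY-avoids-v f∈ = [ (λ f∈X → X-avoids (inside-incident G (Y-inside e∈Y) (joins-incident G e-joins)) v∉S f∈X)
                       , (λ f∈YS → v∉S ∘ inside-incident G (proj₂ (∈induced⁻ G f∈YS))) ]′ (x∈p∪q⁻ _ _ f∈)
      e∈new : ⁅ e ⁆ ⊆ X ∪ induced G Y (S ∪ ⁅ v ⁆)
      e∈new = ⁅x⁆⊆p (⊆∪ʳ (∈induced⁺ G e∈Y (joins-inside G e-joins)))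

    rank-gain : ∀ S → u ∈ S → AvoidsOutside S → r (X ∪ induced G Y S) + ∣ T ∣ ≤ r (X ∪ Y) + ∣ S ∣
    rank-gain S = go ∣ T ∣ S (m≤m+n ∣ T ∣ ∣ S ∣)
      where
      go : ∀ k S → ∣ T ∣ ≤ k + ∣ S ∣ → u ∈ S → AvoidsOutside S
        → r (X ∪ induced G Y S) + ∣ T ∣ ≤ r (X ∪ Y) + ∣ S ∣
      go k S bound u∈S X-avoids with ∣ S ∣ <? ∣ T ∣
      go k S bound u∈S X-avoids | no S≮T =
        +-mono-≤ (rank-mono M (∪-least ⊆∪ˡ (⊆∪ʳ ∘ induced⊆ G))) (≮⇒≥ S≮T)
      go zero S bound u∈S X-avoids | yes S<T = ⊥-elim (<⇒≱ S<T bound)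
      go (suc k) S bound u∈S X-avoids | yes S<T with ∣p∣<∣q∣⇒∃x∈q∖p S<T
      ... | w , w∈T , w∉S with exit G (Y-spans w∈T) u∈S w∉S
      ... | e , v , e∈Y , v∉S , e-joins = ≤-pred (begin
          suc (r (X ∪ induced G Y S) + ∣ T ∣) ≤⟨ +-monoˡ-≤ ∣ T ∣ (rank-extend X-avoids e∈Y v∉S e-joins) ⟩
          r (X ∪ induced G Y S') + ∣ T ∣      ≤⟨ go k S' bound' (⊆∪ˡ u∈S) (λ w∈T w∉S' → X-avoids w∈T (w∉S' ∘ ⊆∪ˡ)) ⟩
          r (X ∪ Y) + ∣ S' ∣                  ≡⟨ cong (r (X ∪ Y) +_) ∣S'∣≡1+∣S∣ ⟩
          r (X ∪ Y) + suc ∣ S ∣               ≡⟨ +-suc (r (X ∪ Y)) ∣ S ∣ ⟩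
          suc (r (X ∪ Y) + ∣ S ∣)             ∎)
        where
        open ≤-Reasoning
        S' : Subset (nV G)
        S' = S ∪ ⁅ v ⁆
        ∣S'∣≡1+∣S∣ : ∣ S' ∣ ≡ suc ∣ S ∣
        ∣S'∣≡1+∣S∣ = x∉p⇒∣p∪⁅x⁆∣≡1+∣p∣ v∉S
        bound' : ∣ T ∣ ≤ k + ∣ S' ∣
        bound' = subst (∣ T ∣ ≤_) (sym (trans (cong (k +_) ∣S'∣≡1+∣S∣) (+-suc k ∣ S ∣))) bound

  -- Growing from W to all of V(G) gains ∣ V ∣ − ∣ W ∣, and r(E) ≤ ∣ V ∣ by condition (2).
  rank-≤-vertices : Connected G → ∀ {W Z} {u : Vtx G} → u ∈ W → (∀ {e} → e ∈ Z → Inside G W e)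
    → r Z ≤ ∣ W ∣
  rank-≤-vertices conn {W} {Z} {u} u∈W Z-inside = +-cancelʳ-≤ ∣ V ∣ _ _ (begin
    r Z + ∣ V ∣                   ≤⟨ +-monoˡ-≤ ∣ V ∣ (rank-mono M (⊆∪ʳ ∘ Z⊆W)) ⟩
    r (∅ ∪ induced G ⊤ W) + ∣ V ∣  ≤⟨ rank-gain W u∈W (λ _ _ e∈∅ → ⊥-elim (∉⊥ e∈∅)) ⟩
    r (∅ ∪ ⊤) + ∣ W ∣             ≤⟨ +-monoˡ-≤ ∣ W ∣ (≤-trans (rank-mono M ⊆⊤) rank-E≤∣V∣) ⟩
    ∣ V ∣ + ∣ W ∣                 ≡⟨ +-comm ∣ V ∣ ∣ W ∣ ⟩
    ∣ W ∣ + ∣ V ∣                 ∎)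
    where
    open ≤-Reasoning
    V : Subset (nV G)
    V = ⊤
    open Growth ∅ ⊤ V u (λ _ → ∈⊤ , ∈⊤) (λ _ → conn u _)
    Z⊆W : Z ⊆ induced G ⊤ W
    Z⊆W e∈Z = ∈induced⁺ G ∈⊤ (Z-inside e∈Z)
    rank-E≤∣V∣ : r ⊤ ≤ ∣ V ∣
    rank-E≤∣V∣ = proj₁ wf u ⊤ V (λ _ → mk⇔ (λ _ → conn u _) (λ _ → ∈⊤)) (λ _ → mk⇔ (λ _ → conn u _) (λ _ → ∈⊤))

-- Components of G[C]

module Component {n} (G : Graph n) (C : Subset n) (x : Vtx G) where

  V : Subset (nV G)
  V = reachable G C x

  A? : ∀ c → Dec (c ∈ C × end₁ G c ∈ V)
  A? c = (c ∈? C) ×-dec (end₁ G c ∈? V)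

  A : Subset n
  A = select A?

  x∈V : x ∈ V
  x∈V = reachable⁺ G C x here

  ∈A⁻ : ∀ {c} → c ∈ A → c ∈ C × end₁ G c ∈ V
  ∈A⁻ = ∈-select⁻ A?

  A⊆C : A ⊆ C
  A⊆C = proj₁ ∘ ∈A⁻

  C-inside : ∀ {c w} → c ∈ C → Incident G c w → w ∈ V → Inside G V c
  C-inside c∈C (inj₁ refl) w∈V = w∈V , reachable⁺ G C x (fwd _ c∈C (reachable⁻ G C x w∈V))
  C-inside c∈C (inj₂ refl) w∈V = reachable⁺ G C x (bwd _ c∈C (reachable⁻ G C x w∈V)) , w∈V

  ∈A⁺ : ∀ {c w} → c ∈ C → Incident G c w → w ∈ V → c ∈ A
  ∈A⁺ c∈C c~w w∈V = ∈-select⁺ A? (c∈C , proj₁ (C-inside c∈C c~w w∈V))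

  A-inside : ∀ {c} → c ∈ A → Inside G V c
  A-inside c∈A = let (c∈C , c₁∈V) = ∈A⁻ c∈A in C-inside c∈C (inj₁ refl) c₁∈V

  reach-via-A : ∀ {w} → w ∈ V → Reach G A x w
  reach-via-A = restrict ∘ reachable⁻ G C x
    where
    restrict : ∀ {w} → Reach G C x w → Reach G A x w
    restrict here = here
    restrict (fwd c c∈C q) = fwd c (∈A⁺ c∈C (inj₁ refl) (reachable⁺ G C x q)) (restrict q)
    restrict (bwd c c∈C q) = bwd c (∈A⁺ c∈C (inj₂ refl) (reachable⁺ G C x q)) (restrict q)

  avoids-V : ∀ {X w} → X ⊆ C → Disjoint X A → w ∈ V → Avoids G X w
  avoids-V X⊆C X∩A=∅ w∈V c∈X c~w = X∩A=∅ c∈X (∈A⁺ (X⊆C c∈X) c~w w∈V)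

-- A circuit meeting three components

inconsistent-bounds : ∀ α β γ t v₁ vy ρ ρAyT ρAyTp ρCT ρCTp ρBT →
  α + β + t ≤ ρAyT + v₁ →
  ρAyTp ≤ t + vy →
  ρCT + α ≤ ρ + t →
  ρCTp + ρAyT ≤ ρAyTp + ρCT →
  α + γ + t ≤ ρBT + v₁ →
  suc ρBT + vy ≤ ρCTp + 1 →
  β + γ + v₁ ≤ ρ + 1 →
  suc ρ ≤ α + (β + γ) → ⊥
inconsistent-bounds α β γ t v₁ vy ρ ρAyT ρAyTp ρCT ρCTp ρBT h₁ h₂ h₃ h₄ h₅ h₆ h₇ h₈ =
  <-irrefl refl (subst (_≤ rhs) (weighted-sum α β γ t v₁ vy ρ ρAyT ρAyTp ρCT ρCTp ρBT) sum)
  where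
  rhs : ℕ
  rhs = (ρAyT + v₁) + (t + vy) + (ρ + t) + (ρAyTp + ρCT) + (ρBT + v₁) + (ρCTp + 1) + 2 * (ρ + 1) + 3 * (α + (β + γ))
  sum : (α + β + t) + ρAyTp + (ρCT + α) + (ρCTp + ρAyT) + (α + γ + t) + (suc ρBT + vy) + 2 * (β + γ + v₁) + 3 * suc ρ ≤ rhs
  sum = +-mono-≤ (+-mono-≤ (+-mono-≤ (+-mono-≤ (+-mono-≤ (+-mono-≤ (+-mono-≤ h₁ h₂) h₃) h₄) h₅) h₆)
          (*-monoʳ-≤ 2 h₇)) (*-monoʳ-≤ 3 h₈)
  weighted-sum : ∀ α β γ t v₁ vy ρ ρAyT ρAyTp ρCT ρCTp ρBT →
    (α + β + t) + ρAyTp + (ρCT + α) + (ρCTp + ρAyT) + (α + γ + t) + (suc ρBT + vy) + 2 * (β + γ + v₁) + 3 * suc ρ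
    ≡ suc ((ρAyT + v₁) + (t + vy) + (ρ + t) + (ρAyTp + ρCT) + (ρBT + v₁) + (ρCTp + 1) + 2 * (ρ + 1) + 3 * (α + (β + γ)))
  weighted-sum = solve-∀

module ThreeComponents {n} (M : Matroid n) (G : Graph n) (conn : Connected G) (wf : IsWeakFramework M G)
  {C : Subset n} (circuit : IsCircuit M C) {e f g : Fin n} (e∈C : e ∈ C) (f∈C : f ∈ C) (g∈C : g ∈ C)
  (e≁f : ¬ SameComp G C e f) (e≁g : ¬ SameComp G C e g) (f≁g : ¬ SameComp G C f g) where

  open WeakFramework M G wf

  private
    r : Subset n → ℕ
    r = rank M

  u : Vtx G
  u = end₁ G e

  module C₁ = Component G C u

  V₁ : Subset (nV G)
  V₁ = C₁.V

  A₁ : Subset n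
  A₁ = C₁.A

  OnC : Vtx G → Set
  OnC w = ∃ λ c → c ∈ C × Incident G c w

  OnC? : ∀ w → Dec (OnC w)
  OnC? w = any? (λ c → (c ∈? C) ×-dec ((end₁ G c ≟ w) ⊎-dec (end₂ G c ≟ w)))

  Admissible : Vtx G → Set
  Admissible w = w ∈ V₁ ⊎ ¬ OnC w

  Admissible? : ∀ w → Dec (Admissible w)
  Admissible? w = (w ∈? V₁) ⊎-dec ¬? (OnC? w)

  admissible-edge? : ∀ c → Dec (Admissible (end₁ G c) × Admissible (end₂ G c))
  admissible-edge? c = Admissible? (end₁ G c) ×-dec Admissible? (end₂ G c)

  admissible-edges : Subset n
  admissible-edges = select admissible-edge?

  T : Subset (nV G)
  T = reachable G admissible-edges u

  T-admissible : ∀ {w} → w ∈ T → Admissible w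
  T-admissible = along ∘ reachable⁻ G admissible-edges u
    where
    along : ∀ {w} → Reach G admissible-edges u w → Admissible w
    along here = inj₁ C₁.x∈V
    along (fwd c c∈ _) = proj₂ (∈-select⁻ admissible-edge? c∈)
    along (bwd c c∈ _) = proj₁ (∈-select⁻ admissible-edge? c∈)

  T∩OnC⊆V₁ : ∀ {w} → w ∈ T → OnC w → w ∈ V₁
  T∩OnC⊆V₁ w∈T w-on-C = [ (λ w∈V₁ → w∈V₁) , (λ ¬on-C → ⊥-elim (¬on-C w-on-C)) ]′ (T-admissible w∈T)

  T-avoids : ∀ {X w} → X ⊆ C → w ∈ T → w ∉ V₁ → Avoids G X w
  T-avoids X⊆C w∈T w∉V₁ c∈X c~w = w∉V₁ (T∩OnC⊆V₁ w∈T (_ , X⊆C c∈X , c~w))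

  V₁⊆T : V₁ ⊆ T
  V₁⊆T = reachable⁺ G admissible-edges u ∘ widen ∘ C₁.reach-via-A
    where
    admissible : ∀ {c} → c ∈ A₁ → c ∈ admissible-edges
    admissible c∈A₁ = let (c₁∈V₁ , c₂∈V₁) = C₁.A-inside c∈A₁ in ∈-select⁺ admissible-edge? (inj₁ c₁∈V₁ , inj₁ c₂∈V₁)
    widen : ∀ {w} → Reach G A₁ u w → Reach G admissible-edges u w
    widen here = here
    widen (fwd c c∈A₁ q) = fwd c (admissible c∈A₁) (widen q)
    widen (bwd c c∈A₁ q) = bwd c (admissible c∈A₁) (widen q)

  u∈T : u ∈ T
  u∈T = V₁⊆T C₁.x∈V

  ET : Subset n
  ET = induced G ⊤ T

  ET-inside : ∀ {c} → c ∈ ET → Inside G T c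
  ET-inside = proj₂ ∘ ∈induced⁻ G

  ET-spans : ∀ {w} → w ∈ T → Reach G ET u w
  ET-spans = within ∘ reachable⁻ G admissible-edges u
    where
    within : ∀ {w} → Reach G admissible-edges u w → Reach G ET u w
    within here = here
    within (fwd c c∈ q) =
      fwd c (∈induced⁺ G ∈⊤ (reachable⁺ G _ u q , reachable⁺ G _ u (fwd c c∈ q))) (within q)
    within (bwd c c∈ q) =
      bwd c (∈induced⁺ G ∈⊤ (reachable⁺ G _ u (bwd c c∈ q) , reachable⁺ G _ u q)) (within q)

  f₁∉T : end₁ G f ∉ T
  f₁∉T f₁∈T = e≁f (reachable⁻ G C u (T∩OnC⊆V₁ f₁∈T (f , f∈C , inj₁ refl)))

  leaving : ∃₂ λ p y → p ∈ ⊤ × y ∉ T × Joins G T p y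
  leaving = exit G (conn u (end₁ G f)) u∈T f₁∉T

  p : Fin n
  p = proj₁ leaving

  y : Vtx G
  y = proj₁ (proj₂ leaving)

  y∉T : y ∉ T
  y∉T = proj₁ (proj₂ (proj₂ (proj₂ leaving)))

  p-joins : Joins G T p y
  p-joins = proj₂ (proj₂ (proj₂ (proj₂ leaving)))

  T-closed : ∀ {c w} → Joins G T c w → Admissible w → w ∈ T
  T-closed {c} (inj₁ (c₁∈T , refl)) w-adm = reachable⁺ G _ u
    (fwd c (∈-select⁺ admissible-edge? (T-admissible c₁∈T , w-adm)) (reachable⁻ G _ u c₁∈T))
  T-closed {c} (inj₂ (c₂∈T , refl)) w-adm = reachable⁺ G _ u
    (bwd c (∈-select⁺ admissible-edge? (w-adm , T-admissible c₂∈T)) (reachable⁻ G _ u c₂∈T))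

  y-on-C : OnC y
  y-on-C with OnC? y
  ... | yes y-on = y-on
  ... | no ¬y-on = ⊥-elim (y∉T (T-closed p-joins (inj₂ ¬y-on)))

  y∉V₁ : y ∉ V₁
  y∉V₁ = y∉T ∘ T-closed p-joins ∘ inj₁

  module C₂ = Component G C y

  Vy : Subset (nV G)
  Vy = C₂.V

  Ay : Subset n
  Ay = C₂.A

  Vy-on-C : ∀ {w} → w ∈ Vy → OnC w
  Vy-on-C = last-edge ∘ reachable⁻ G C y
    where
    last-edge : ∀ {w} → Reach G C y w → OnC w
    last-edge here = y-on-C
    last-edge (fwd c c∈C _) = c , c∈C , inj₂ refl
    last-edge (bwd c c∈C _) = c , c∈C , inj₁ refl

  Vy∩V₁=∅ : Disjoint Vy V₁
  Vy∩V₁=∅ w∈Vy w∈V₁ =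
    y∉V₁ (reachable⁺ G C u (Reach-trans G (reachable⁻ G C u w∈V₁) (Reach-sym G (reachable⁻ G C y w∈Vy))))

  Vy∩T=∅ : Disjoint Vy T
  Vy∩T=∅ w∈Vy w∈T = Vy∩V₁=∅ w∈Vy (T∩OnC⊆V₁ w∈T (Vy-on-C w∈Vy))

  B? : ∀ c → Dec (c ∈ C × end₁ G c ∉ V₁ × end₁ G c ∉ Vy)
  B? c = (c ∈? C) ×-dec (¬? (end₁ G c ∈? V₁) ×-dec ¬? (end₁ G c ∈? Vy))

  B : Subset n
  B = select B?

  B⊆C : B ⊆ C
  B⊆C = proj₁ ∘ ∈-select⁻ B?

  A₁∩Ay=∅ : Disjoint A₁ Ay
  A₁∩Ay=∅ c∈A₁ c∈Ay = Vy∩V₁=∅ (proj₂ (C₂.∈A⁻ c∈Ay)) (proj₂ (C₁.∈A⁻ c∈A₁))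

  A₁∩B=∅ : Disjoint A₁ B
  A₁∩B=∅ c∈A₁ c∈B = proj₁ (proj₂ (∈-select⁻ B? c∈B)) (proj₂ (C₁.∈A⁻ c∈A₁))

  Ay∩B=∅ : Disjoint Ay B
  Ay∩B=∅ c∈Ay c∈B = proj₂ (proj₂ (∈-select⁻ B? c∈B)) (proj₂ (C₂.∈A⁻ c∈Ay))

  C⊆A₁∪Ay∪B : C ⊆ A₁ ∪ (Ay ∪ B)
  C⊆A₁∪Ay∪B {c} c∈C with end₁ G c ∈? V₁ | end₁ G c ∈? Vy
  ... | yes c₁∈V₁ | _ = ⊆∪ˡ (C₁.∈A⁺ c∈C (inj₁ refl) c₁∈V₁)
  ... | no _ | yes c₁∈Vy = ⊆∪ʳ (⊆∪ˡ (C₂.∈A⁺ c∈C (inj₁ refl) c₁∈Vy))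
  ... | no c₁∉V₁ | no c₁∉Vy = ⊆∪ʳ (⊆∪ʳ (∈-select⁺ B? (c∈C , c₁∉V₁ , c₁∉Vy)))

  e∈A₁ : e ∈ A₁
  e∈A₁ = C₁.∈A⁺ e∈C (inj₁ refl) C₁.x∈V

  cy : Fin n
  cy = proj₁ y-on-C

  cy∈Ay : cy ∈ Ay
  cy∈Ay = C₂.∈A⁺ (proj₁ (proj₂ y-on-C)) (proj₂ (proj₂ y-on-C)) C₂.x∈V

  B-nonempty : ∃ λ b → b ∈ B
  B-nonempty with end₁ G f ∈? Vy
  ... | no f₁∉Vy = f , ∈-select⁺ B? (f∈C , e≁f ∘ reachable⁻ G C u , f₁∉Vy)
  ... | yes f₁∈Vy = g , ∈-select⁺ B? (g∈C , e≁g ∘ reachable⁻ G C u ,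
          λ g₁∈Vy → f≁g (Reach-trans G (Reach-sym G (reachable⁻ G C y f₁∈Vy)) (reachable⁻ G C y g₁∈Vy)))

  A₁⊆ET[V₁] : A₁ ⊆ induced G ET V₁
  A₁⊆ET[V₁] c∈A₁ = ∈induced⁺ G (∈induced⁺ G ∈⊤ (inside-mono G V₁⊆T (C₁.A-inside c∈A₁))) (C₁.A-inside c∈A₁)

  rank-part∪ET : ∀ {X c} → X ⊆ C → Disjoint A₁ X → c ∈ C → c ∉ A₁ → c ∉ X
    → ∣ A₁ ∣ + ∣ X ∣ + ∣ T ∣ ≤ r (X ∪ ET) + ∣ V₁ ∣
  rank-part∪ET {X} X⊆C A₁∩X=∅ c∈C c∉A₁ c∉X = begin
    ∣ A₁ ∣ + ∣ X ∣ + ∣ T ∣           ≤⟨ +-monoˡ-≤ ∣ T ∣ (rank-of-proper-disjoint-parts M circuit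
                                          A₁∩X=∅ (∪-least C₁.A⊆C X⊆C) c∈C (∉∪ c∉A₁ c∉X)) ⟩
    r (A₁ ∪ X) + ∣ T ∣               ≤⟨ +-monoˡ-≤ ∣ T ∣ (rank-mono M (∪-least (⊆∪ʳ ∘ A₁⊆ET[V₁]) ⊆∪ˡ)) ⟩
    r (X ∪ induced G ET V₁) + ∣ T ∣  ≤⟨ Growth.rank-gain X ET T u ET-inside ET-spans V₁ C₁.x∈V (T-avoids X⊆C) ⟩
    r (X ∪ ET) + ∣ V₁ ∣              ∎
    where open ≤-Reasoning

  Ay∪ET+p : Subset n
  Ay∪ET+p = (Ay ∪ ET) ∪ ⁅ p ⁆

  C∪ET+p : Subset n
  C∪ET+p = (C ∪ ET) ∪ ⁅ p ⁆

  rank-Ay∪ET : ∣ A₁ ∣ + ∣ Ay ∣ + ∣ T ∣ ≤ r (Ay ∪ ET) + ∣ V₁ ∣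
  rank-Ay∪ET = rank-part∪ET C₂.A⊆C A₁∩Ay=∅ (B⊆C b∈B) (λ b∈A₁ → A₁∩B=∅ b∈A₁ b∈B) (λ b∈Ay → Ay∩B=∅ b∈Ay b∈B)
    where
    b∈B : proj₁ B-nonempty ∈ B
    b∈B = proj₂ B-nonempty

  rank-Ay∪ET+p : r Ay∪ET+p ≤ ∣ T ∣ + ∣ Vy ∣
  rank-Ay∪ET+p = ≤-trans (rank-≤-vertices conn (⊆∪ˡ u∈T) Ay∪ET+p-inside) (∣p∪q∣≤∣p∣+∣q∣ T Vy)
    where
    Ay∪ET+p-inside : ∀ {c} → c ∈ Ay∪ET+p → Inside G (T ∪ Vy) c
    Ay∪ET+p-inside c∈ with x∈p∪q⁻ (Ay ∪ ET) ⁅ p ⁆ c∈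
    ... | inj₂ c∈⁅p⁆ = subst (Inside G (T ∪ Vy)) (sym (x∈⁅y⁆⇒x≡y p c∈⁅p⁆))
                         (inside-mono G (∪-least ⊆∪ˡ (⊆∪ʳ ∘ ⁅x⁆⊆p C₂.x∈V)) (joins-inside G p-joins))
    ... | inj₁ c∈Ay∪ET = [ inside-mono G ⊆∪ʳ ∘ C₂.A-inside , inside-mono G ⊆∪ˡ ∘ ET-inside ]′
                           (x∈p∪q⁻ Ay ET c∈Ay∪ET)

  rank-C∪ET : r (C ∪ ET) + ∣ A₁ ∣ ≤ r C + ∣ T ∣
  rank-C∪ET = begin
    r (C ∪ ET) + ∣ A₁ ∣      ≤⟨ +-monoʳ-≤ (r (C ∪ ET)) (≤-trans
                                 (rank-of-proper-part M circuit C₁.A⊆C (C₂.A⊆C cy∈Ay) (λ cy∈A₁ → A₁∩Ay=∅ cy∈A₁ cy∈Ay))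
                                 (rank-mono M (λ c∈A₁ → x∈p∩q⁺ (C₁.A⊆C c∈A₁ , induced⊆ G (A₁⊆ET[V₁] c∈A₁))))) ⟩
    r (C ∪ ET) + r (C ∩ ET)  ≤⟨ rank-sub M C ET ⟩
    r C + r ET               ≤⟨ +-monoʳ-≤ (r C) (rank-≤-vertices conn u∈T ET-inside) ⟩
    r C + ∣ T ∣              ∎
    where open ≤-Reasoning

  submodularity-at-p : r C∪ET+p + r (Ay ∪ ET) ≤ r Ay∪ET+p + r (C ∪ ET)
  submodularity-at-p = ≤-trans (+-mono-≤ (rank-mono M (∪-least ⊆∪ʳ (⊆∪ˡ ∘ ⊆∪ʳ)))
                                        (rank-mono M (λ c∈ → x∈p∩q⁺ (⊆∪ˡ c∈ , ∪-least (⊆∪ˡ ∘ C₂.A⊆C) ⊆∪ʳ c∈))))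
                              (rank-sub M Ay∪ET+p (C ∪ ET))

  rank-B∪ET : ∣ A₁ ∣ + ∣ B ∣ + ∣ T ∣ ≤ r (B ∪ ET) + ∣ V₁ ∣
  rank-B∪ET = rank-part∪ET B⊆C A₁∩B=∅ (C₂.A⊆C cy∈Ay) (λ cy∈A₁ → A₁∩Ay=∅ cy∈A₁ cy∈Ay) (Ay∩B=∅ cy∈Ay)

  B∪ET-avoids-Vy : ∀ {w} → w ∈ Vy → Avoids G (B ∪ ET) w
  B∪ET-avoids-Vy w∈Vy c∈ = [ (λ c∈B → C₂.avoids-V B⊆C (λ c∈B c∈Ay → Ay∩B=∅ c∈Ay c∈B) w∈Vy c∈B)
                           , (λ c∈ET → Vy∩T=∅ w∈Vy ∘ inside-incident G (ET-inside c∈ET)) ]′ (x∈p∪q⁻ B ET c∈)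

  rank-C∪ET+p-over-B∪ET : suc (r (B ∪ ET)) + ∣ Vy ∣ ≤ r C∪ET+p + 1
  rank-C∪ET+p-over-B∪ET = begin
    suc (r (B ∪ ET)) + ∣ Vy ∣             ≤⟨ +-monoˡ-≤ ∣ Vy ∣ (rank-suc-at-new-vertex (B∪ET-avoids-Vy C₂.x∈V)
                                                (joins-incident G p-joins) (joins-nonloop G y∉T p-joins)) ⟩
    r B∪ET+p + ∣ Vy ∣                         ≤⟨ +-monoˡ-≤ ∣ Vy ∣ (rank-mono M ⊆∪ˡ) ⟩
    r (B∪ET+p ∪ induced G Ay ⁅ y ⁆) + ∣ Vy ∣  ≤⟨ Growth.rank-gain B∪ET+p Ay Vy y C₂.A-inside C₂.reach-via-A
                                                ⁅ y ⁆ (x∈⁅x⁆ y) B∪ET+p-avoids ⟩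
    r (B∪ET+p ∪ Ay) + ∣ ⁅ y ⁆ ∣               ≤⟨ +-mono-≤ (rank-mono M B∪ET+p∪Ay⊆C∪ET+p) (≤-reflexive (∣⁅x⁆∣≡1 y)) ⟩
    r C∪ET+p + 1                               ∎
    where
    open ≤-Reasoning
    B∪ET+p : Subset n
    B∪ET+p = (B ∪ ET) ∪ ⁅ p ⁆
    B∪ET+p-avoids : ∀ {w} → w ∈ Vy → w ∉ ⁅ y ⁆ → Avoids G B∪ET+p w
    B∪ET+p-avoids w∈Vy w∉⁅y⁆ c∈ with x∈p∪q⁻ (B ∪ ET) ⁅ p ⁆ c∈
    ... | inj₁ c∈B∪ET = B∪ET-avoids-Vy w∈Vy c∈B∪ET
    ... | inj₂ c∈⁅p⁆ = λ c~w → [ Vy∩T=∅ w∈Vy , w∉⁅y⁆ ]′ (x∈p∪q⁻ T ⁅ y ⁆ (inside-incident G (joins-inside G p-joins)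
                         (subst (λ c → Incident G c _) (x∈⁅y⁆⇒x≡y p c∈⁅p⁆) c~w)))
    B∪ET+p∪Ay⊆C∪ET+p : B∪ET+p ∪ Ay ⊆ C∪ET+p
    B∪ET+p∪Ay⊆C∪ET+p = ∪-least (∪-least (∪-least (⊆∪ˡ ∘ ⊆∪ˡ ∘ B⊆C) (⊆∪ˡ ∘ ⊆∪ʳ)) ⊆∪ʳ) (⊆∪ˡ ∘ ⊆∪ˡ ∘ C₂.A⊆C)

  rank-C-over-Ay∪B : ∣ Ay ∣ + ∣ B ∣ + ∣ V₁ ∣ ≤ r C + 1
  rank-C-over-Ay∪B = begin
    ∣ Ay ∣ + ∣ B ∣ + ∣ V₁ ∣                  ≤⟨ +-monoˡ-≤ ∣ V₁ ∣ (≤-trans (rank-of-proper-disjoint-parts M circuit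
                                                 Ay∩B=∅ Ay∪B⊆C e∈C (∉∪ (A₁∩Ay=∅ e∈A₁) (A₁∩B=∅ e∈A₁)))
                                                 (rank-mono M ⊆∪ˡ)) ⟩
    r ((Ay ∪ B) ∪ induced G A₁ ⁅ u ⁆) + ∣ V₁ ∣ ≤⟨ Growth.rank-gain (Ay ∪ B) A₁ V₁ u C₁.A-inside C₁.reach-via-A
                                                 ⁅ u ⁆ (x∈⁅x⁆ u) (λ w∈V₁ _ → C₁.avoids-V Ay∪B⊆C Ay∪B∩A₁=∅ w∈V₁) ⟩
    r ((Ay ∪ B) ∪ A₁) + ∣ ⁅ u ⁆ ∣            ≤⟨ +-mono-≤ (rank-mono M (∪-least Ay∪B⊆C C₁.A⊆C)) (≤-reflexive (∣⁅x⁆∣≡1 u)) ⟩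
    r C + 1                                  ∎
    where
    open ≤-Reasoning
    Ay∪B⊆C : Ay ∪ B ⊆ C
    Ay∪B⊆C = ∪-least C₂.A⊆C B⊆C
    Ay∪B∩A₁=∅ : Disjoint (Ay ∪ B) A₁
    Ay∪B∩A₁=∅ c∈ c∈A₁ = ∉∪ (A₁∩Ay=∅ c∈A₁) (A₁∩B=∅ c∈A₁) c∈

  rank-C<∣C∣ : suc (r C) ≤ ∣ A₁ ∣ + (∣ Ay ∣ + ∣ B ∣)
  rank-C<∣C∣ = begin
    suc (r C)                   ≤⟨ proj₁ circuit ⟩
    ∣ C ∣                       ≤⟨ p⊆q⇒∣p∣≤∣q∣ C⊆A₁∪Ay∪B ⟩
    ∣ A₁ ∪ (Ay ∪ B) ∣           ≤⟨ ∣p∪q∣≤∣p∣+∣q∣ A₁ (Ay ∪ B) ⟩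
    ∣ A₁ ∣ + ∣ Ay ∪ B ∣         ≤⟨ +-monoʳ-≤ ∣ A₁ ∣ (∣p∪q∣≤∣p∣+∣q∣ Ay B) ⟩
    ∣ A₁ ∣ + (∣ Ay ∣ + ∣ B ∣)   ∎
    where open ≤-Reasoning

  absurd : ⊥
  absurd = inconsistent-bounds (∣ A₁ ∣) (∣ Ay ∣) (∣ B ∣) (∣ T ∣) (∣ V₁ ∣) (∣ Vy ∣)
    (r C) (r (Ay ∪ ET)) (r Ay∪ET+p) (r (C ∪ ET)) (r C∪ET+p) (r (B ∪ ET))
    rank-Ay∪ET rank-Ay∪ET+p rank-C∪ET submodularity-at-p rank-B∪ET rank-C∪ET+p-over-B∪ET rank-C-over-Ay∪B rank-C<∣C∣

lemma3p7 : (n : ℕ) → 4 ≤ n → (M : Matroid n) (G : Graph n)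
    → Connected G → IsWeakFramework M G
    → (C : Subset n) → IsCircuit M C
    → AtMostTwoComponents G C
lemma3p7 n _ M G conn wf C circuit e f g e∈C f∈C g∈C
  with Reach? G C (end₁ G e) (end₁ G f) | Reach? G C (end₁ G e) (end₁ G g) | Reach? G C (end₁ G f) (end₁ G g)
... | yes e∼f | _ | _ = inj₁ e∼f
... | no _ | yes e∼g | _ = inj₂ (inj₁ e∼g)
... | no _ | no _ | yes f∼g = inj₂ (inj₂ f∼g)
... | no e≁f | no e≁g | no f≁g =
  ⊥-elim (ThreeComponents.absurd M G conn wf circuit e∈C f∈C g∈C e≁f e≁g f≁g)
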